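{- Let $X=\{x,y,z\}$, $N=\{1,\dots,n\}$ with $n\ge 3$, and let $g:NP\to X$ be strategy-proof with $\mathrm{Range}(g|NP^{*})=\{y,z\}$. Define the profiles $L1$: individuals $1,\dots,n-2$ have $x\succ y\succ z$, individual $n-1$ has $z\succ y\succ x$, individual $n$ has $x\succ y\succ z$; $L2$: individual $1$ has $z\succ x\succ y$, individuals $2,\dots,n-2$ have $x\succ z\succ y$, individual $n-1$ has $y\succ x\succ z$, individual $n$ has $x\succ z\succ y$; $L3$: individuals $1,\dots,n-2$ have $x\succ z\succ y$, individual $n-1$ has $y\succ x\succ z$, individual $n$ has $z\succ x\succ y$. Let $\mathcal{L}$ be the set of all profiles obtained from $L1$, $L2$, $L3$ by any combination of the following operations: interchanging $y$ and $z$ in every individual's ordering; interchanging the orderings of individuals $n-1$ and $n$; permuting the orderings among individuals $1,\dots,n-2$. If $x\in\mathrm{Range}(g)$, then $g(u)=x$ for some $u\in\mathcal{L}$.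
   Context: A profile is a map $p:N\to L(X)$, where $L(X)$ is the set of strict linear orderings of $X$; write $a\succ_{p(i)}b$ if individual $i$ strictly prefers $a$ to $b$ at $p$. $NP$ is the set of all profiles $p$ such that for every pair of distinct alternatives $a,b$ there exist individuals $i,j$ with $a\succ_{p(i)}b$ and $b\succ_{p(j)}a$. $NP^{*}$ is the set of profiles $u\in NP$ with $u(n-1)=u(n)$. Two profiles $p,q$ are $h$-variants if $q(i)=p(i)$ for all $i\neq h$. A rule $g:NP\to X$ is strategy-proof if there are no $h\in N$ and $h$-variants $p,p'\in NP$ with $g(p')\succ_{p(h)}g(p)$. -}

module Defs where

open import Data.Nat using (ℕ; suc; _<_; _≟_; _<?_)
open import Data.Fin using (Fin; toℕ; fromℕ; fromℕ<; inject₁)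
open import Data.Fin.Permutation using (Permutation′; _⟨$⟩ʳ_; transpose)
open import Data.Product using (Σ; ∃; _×_; _,_; proj₁)
open import Data.Sum using (_⊎_)
open import Relation.Nullary using (¬_; yes; no)
open import Relation.Binary.PropositionalEquality using (_≡_; _≢_)

data X : Set where
  x y z : X

-- L(X): the six strict linear orderings of X, named top-to-bottom.
data LO : Set where
  xyz xzy yxz yzx zxy zyx : LO

-- position of an alternative in an ordering (0 = best)
rank : LO → X → ℕ
rank xyz x = 0
rank xyz y = 1
rank xyz z = 2
rank xzy x = 0
rank xzy z = 1
rank xzy y = 2
rank yxz y = 0
rank yxz x = 1
rank yxz z = 2
rank yzx y = 0
rank yzx z = 1
rank yzx x = 2
rank zxy z = 0
rank zxy x = 1
rank zxy y = 2
rank zyx z = 0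
rank zyx y = 1
rank zyx x = 2

_≻[_]_ : X → LO → X → Set
a ≻[ o ] b = rank o a < rank o b

-- Individuals N = {1,…,n} with n = m + 2 are Fin (suc (suc m)) (0-based):
-- individual n is 'lastI', individual n-1 is 'prevI',
-- individuals 1,…,n-2 are the indices with toℕ i < m.
module _ (m : ℕ) where

  N : Set
  N = Fin (suc (suc m))

  Profile : Set
  Profile = N → LO

  lastI : N
  lastI = fromℕ (suc m)

  prevI : N
  prevI = inject₁ (fromℕ m)

  NP : Profile → Set
  NP p = ∀ a b → a ≢ b → ∃ λ i → ∃ λ j → (a ≻[ p i ] b) × (b ≻[ p j ] a)

  NP* : Profile → Set
  NP* u = NP u × (u prevI ≡ u lastI)

  Variant : N → Profile → Profile → Set
  Variant h p q = ∀ i → i ≢ h → q i ≡ p i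

  Rule : Set
  Rule = (p : Profile) → NP p → X

  StrategyProof : Rule → Set
  StrategyProof g = ∀ h p p' (np : NP p) (np' : NP p') →
    Variant h p p' → ¬ (g p' np' ≻[ p h ] g p np)

  RangeNP*-yz : Rule → Set
  RangeNP*-yz g =
    (∀ u (nu : NP* u) → (g u (proj₁ nu) ≡ y) ⊎ (g u (proj₁ nu) ≡ z))
    × (Σ Profile λ u → Σ (NP* u) λ nu → g u (proj₁ nu) ≡ y)
    × (Σ Profile λ u → Σ (NP* u) λ nu → g u (proj₁ nu) ≡ z)

  InRange : Rule → X → Set
  InRange g a = Σ Profile λ p → Σ (NP p) λ np → g p np ≡ a

  build : (ℕ → LO) → LO → LO → Profile
  build f a b i with toℕ i <? m
  ... | yes _ = f (toℕ i)
  ... | no _ with toℕ i ≟ m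
  ...   | yes _ = a
  ...   | no _ = b

  L1 : Profile
  L1 = build (λ _ → xyz) zyx xyz

  L2 : Profile
  L2 = build (λ { 0 → zxy ; _ → xzy }) yxz xzy

  L3 : Profile
  L3 = build (λ _ → xzy) yxz zxy

  swapYZ : LO → LO
  swapYZ xyz = xzy
  swapYZ xzy = xyz
  swapYZ yxz = zxy
  swapYZ zxy = yxz
  swapYZ yzx = zyx
  swapYZ zyx = yzx

  data InL : Profile → Set where
    base1 : InL L1
    base2 : InL L2
    base3 : InL L3
    opYZ : ∀ {p} → InL p → InL (λ i → swapYZ (p i))
    opLast : ∀ {p} → InL p → InL (λ i → p (transpose prevI lastI ⟨$⟩ʳ i))
    opPerm : ∀ {p} (σ : Permutation′ (suc (suc m))) →
      σ ⟨$⟩ʳ prevI ≡ prevI → σ ⟨$⟩ʳ lastI ≡ lastI →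
      InL p → InL (λ i → p (σ ⟨$⟩ʳ i))

-- Strategy-proofness implies Maskin monotonicity: if x is chosen at p and
-- we pass to q individual by individual, never letting x fall relative to
-- another alternative, then x stays chosen ('monotone'); the only care
-- needed is that every intermediate profile lies in NP, which holds when
-- each ordered pair of alternatives is ranked the same way by a single
-- individual at both p and q ('Covers').
--
-- Start from p with g p = x.  As p ∈ NP, some a ranks y above x and some
-- b ranks z above x.  Either one of them ranks x last (ordering o), and
-- x stays chosen when a keeps o and everyone else reports the reverse of o;
-- or a reports y≻x≻z and b reports z≻x≻y, and x stays chosen when
-- everyone else puts x on top.  Both target profiles have the shape
-- 'duo a o b o′ c' (a reports o, b reports o′, all others c).  If neither
-- distinguished individual is n-1 or n, the target lies in NP*, which is
-- excluded by the range condition; otherwise it is, up to the symmetries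
-- defining 𝓛, one of L1, L2, L3.

module Submission where

open import Defs
open import Data.Nat using (ℕ; zero; suc; _≤_; _<_; _∸_; _<?_; z≤n; s≤s)
  renaming (_≟_ to _≟ℕ_)
open import Data.Nat.Properties
  using (<-cmp; <-irrefl; n≢0⇒n>0; m∸n≤m; ∸-monoʳ-<; ≤-pred; ≤∧≢⇒<; ≮⇒≥; <⇒≱;
         m≤n⇒m≤1+n; ≤-refl; ≤-reflexive; ≤-antisym; <⇒≤; 1+n≰n; 1+n≢n)
open import Data.Fin using (Fin; toℕ; fromℕ; fromℕ<; inject₁)
  renaming (zero to fzero; suc to fsuc)
open import Data.Fin.Properties
  using (toℕ-injective; toℕ-fromℕ; toℕ-fromℕ<; toℕ-inject₁; toℕ<n)
  renaming (_≟_ to _≟ᶠ_)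
open import Data.Fin.Permutation
  using (Permutation′; _⟨$⟩ʳ_; _⟨$⟩ˡ_; transpose; inverseˡ)
open import Data.Vec.Functional using (updateAt)
open import Data.Vec.Functional.Properties using (updateAt-updates; updateAt-minimal)
open import Data.Product using (Σ; ∃; _×_; _,_; proj₁)
open import Data.Sum using (_⊎_; inj₁; inj₂; [_,_]′)
open import Data.Empty using (⊥; ⊥-elim)
open import Function using (_∘_; const)
open import Relation.Nullary using (¬_; Dec; yes; no; contradiction)
open import Relation.Nullary.Decidable using (dec-true; dec-false)
open import Relation.Binary using (tri<; tri≈; tri>)
open import Relation.Binary.PropositionalEquality

_≟X_ : (a b : X) → Dec (a ≡ b)
x ≟X x = yes refl
x ≟X y = no (λ ())
x ≟X z = no (λ ())
y ≟X x = no (λ ())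
y ≟X y = yes refl
y ≟X z = no (λ ())
z ≟X x = no (λ ())
z ≟X y = no (λ ())
z ≟X z = yes refl

at : LO → ℕ → X
at xyz 0 = x
at xyz 1 = y
at xyz _ = z
at xzy 0 = x
at xzy 1 = z
at xzy _ = y
at yxz 0 = y
at yxz 1 = x
at yxz _ = z
at yzx 0 = y
at yzx 1 = z
at yzx _ = x
at zxy 0 = z
at zxy 1 = x
at zxy _ = y
at zyx 0 = z
at zyx 1 = y
at zyx _ = x

at-rank : ∀ o a → at o (rank o a) ≡ a
at-rank xyz x = refl
at-rank xyz y = refl
at-rank xyz z = refl
at-rank xzy x = refl
at-rank xzy y = refl
at-rank xzy z = refl
at-rank yxz x = refl
at-rank yxz y = refl
at-rank yxz z = refl
at-rank yzx x = refl
at-rank yzx y = refl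
at-rank yzx z = refl
at-rank zxy x = refl
at-rank zxy y = refl
at-rank zxy z = refl
at-rank zyx x = refl
at-rank zyx y = refl
at-rank zyx z = refl

rank-injective : ∀ o {a b} → rank o a ≡ rank o b → a ≡ b
rank-injective o {a} {b} e = begin
  a                ≡⟨ sym (at-rank o a) ⟩
  at o (rank o a)  ≡⟨ cong (at o) e ⟩
  at o (rank o b)  ≡⟨ at-rank o b ⟩
  b                ∎
  where open ≡-Reasoning

≻-irrefl : ∀ o {a} → ¬ (a ≻[ o ] a)
≻-irrefl o = <-irrefl refl

≻-total : ∀ o {u v} → u ≢ v → u ≻[ o ] v ⊎ v ≻[ o ] u
≻-total o {u} {v} u≢v with <-cmp (rank o u) (rank o v)
... | tri< u≻v _ _ = inj₁ u≻v
... | tri≈ _ same _ = contradiction (rank-injective o same) u≢v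
... | tri> _ _ v≻u = inj₂ v≻u

≻-resp : ∀ {o o′ u v} → o ≡ o′ → u ≻[ o ] v → u ≻[ o′ ] v
≻-resp {u = u} {v} = subst (λ w → u ≻[ w ] v)

top-beats : ∀ o {a b} → rank o a ≡ 0 → b ≢ a → a ≻[ o ] b
top-beats o {a} {b} top b≢a =
  subst (_< rank o b) (sym top)
        (n≢0⇒n>0 (λ rb≡0 → b≢a (rank-injective o (trans rb≡0 (sym top)))))

rev : LO → LO
rev xyz = zyx
rev xzy = yzx
rev yxz = zxy
rev yzx = xzy
rev zxy = yxz
rev zyx = xyz

rank-rev : ∀ o a → rank (rev o) a ≡ 2 ∸ rank o a
rank-rev xyz x = refl
rank-rev xyz y = refl
rank-rev xyz z = refl
rank-rev xzy x = refl
rank-rev xzy y = refl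
rank-rev xzy z = refl
rank-rev yxz x = refl
rank-rev yxz y = refl
rank-rev yxz z = refl
rank-rev yzx x = refl
rank-rev yzx y = refl
rank-rev yzx z = refl
rank-rev zxy x = refl
rank-rev zxy y = refl
rank-rev zxy z = refl
rank-rev zyx x = refl
rank-rev zyx y = refl
rank-rev zyx z = refl

rev-involutive : ∀ o → rev (rev o) ≡ o
rev-involutive xyz = refl
rev-involutive xzy = refl
rev-involutive yxz = refl
rev-involutive yzx = refl
rev-involutive zxy = refl
rev-involutive zyx = refl

rev-≢ : ∀ o → o ≢ rev o
rev-≢ xyz ()
rev-≢ xzy ()
rev-≢ yxz ()
rev-≢ yzx ()
rev-≢ zxy ()
rev-≢ zyx ()

-- Every position is at most 2 (as 2 ∸ k ≤ 2 for the position k in the reverse).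
rank≤2 : ∀ o a → rank o a ≤ 2
rank≤2 o a = subst (_≤ 2) rank-o-a (m∸n≤m 2 (rank (rev o) a))
  where
    rank-o-a : 2 ∸ rank (rev o) a ≡ rank o a
    rank-o-a = trans (sym (rank-rev (rev o) a)) (cong (λ w → rank w a) (rev-involutive o))

rev-flips : ∀ o {u v} → v ≻[ o ] u → u ≻[ rev o ] v
rev-flips o {u} {v} v≻u rewrite rank-rev o u | rank-rev o v = ∸-monoʳ-< v≻u (rank≤2 o u)

rev-covers : ∀ o {u v} → u ≢ v → u ≻[ o ] v ⊎ u ≻[ rev o ] v
rev-covers o u≢v with ≻-total o u≢v
... | inj₁ u≻v = inj₁ u≻v
... | inj₂ v≻u = inj₂ (rev-flips o v≻u)

bottom-rev-top : ∀ o {a} → rank o a ≡ 2 → rank (rev o) a ≡ 0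
bottom-rev-top o {a} bottom = trans (rank-rev o a) (cong (2 ∸_) bottom)

y-above-x : ∀ o → y ≻[ o ] x → rank o x ≡ 2 ⊎ o ≡ yxz
y-above-x xyz ()
y-above-x xzy ()
y-above-x yxz _ = inj₂ refl
y-above-x yzx _ = inj₁ refl
y-above-x zxy (s≤s ())
y-above-x zyx _ = inj₁ refl

z-above-x : ∀ o → z ≻[ o ] x → rank o x ≡ 2 ⊎ o ≡ zxy
z-above-x xyz ()
z-above-x xzy ()
z-above-x yxz (s≤s ())
z-above-x yzx _ = inj₁ refl
z-above-x zxy _ = inj₂ refl
z-above-x zyx _ = inj₁ refl

Raises : X → LO → LO → Set
Raises a o o′ = ∀ b → a ≻[ o ] b → a ≻[ o′ ] b

transpose-first : ∀ {n} (i j : Fin n) → transpose i j ⟨$⟩ʳ i ≡ j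
transpose-first i j rewrite dec-true (i ≟ᶠ i) refl = refl

transpose-second : ∀ {n} (i j : Fin n) → transpose i j ⟨$⟩ʳ j ≡ i
transpose-second i j = by-cases (j ≟ᶠ i)
  where
    by-cases : Dec (j ≡ i) → transpose i j ⟨$⟩ʳ j ≡ i
    by-cases (yes refl) = transpose-first i i
    by-cases (no j≢i) rewrite dec-false (j ≟ᶠ i) j≢i | dec-true (j ≟ᶠ j) refl = refl

transpose-other : ∀ {n} (i j k : Fin n) → k ≢ i → k ≢ j → transpose i j ⟨$⟩ʳ k ≡ k
transpose-other i j k k≢i k≢j rewrite dec-false (k ≟ᶠ i) k≢i | dec-false (k ≟ᶠ j) k≢j = refl

permute-injective : ∀ {n} (π : Permutation′ n) {i j} → π ⟨$⟩ʳ i ≡ π ⟨$⟩ʳ j → i ≡ j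
permute-injective π e = trans (sym (inverseˡ π)) (trans (cong (π ⟨$⟩ˡ_) e) (inverseˡ π))

module _ (m : ℕ) where

  prevI-toℕ : toℕ (prevI m) ≡ m
  prevI-toℕ = trans (toℕ-inject₁ (fromℕ m)) (toℕ-fromℕ m)

  lastI-toℕ : toℕ (lastI m) ≡ suc m
  lastI-toℕ = toℕ-fromℕ (suc m)

  Ordinary : N m → Set
  Ordinary i = toℕ i < m

  Special : N m → Set
  Special i = i ≡ prevI m ⊎ i ≡ lastI m

  ordinary≢prev : ∀ {i} → Ordinary i → i ≢ prevI m
  ordinary≢prev i<m refl = <-irrefl prevI-toℕ i<m

  ordinary≢last : ∀ {i} → Ordinary i → i ≢ lastI m
  ordinary≢last i<m refl = 1+n≰n (<⇒≤ (subst (_< m) lastI-toℕ i<m))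

  last≢prev : lastI m ≢ prevI m
  last≢prev e = 1+n≢n (trans (sym lastI-toℕ) (trans (cong toℕ e) prevI-toℕ))

  classify : ∀ i → Special i ⊎ Ordinary i
  classify i with toℕ i <? m
  ... | yes i<m = inj₂ i<m
  ... | no i≮m with toℕ i ≟ℕ m
  ...   | yes i≡m = inj₁ (inj₁ (toℕ-injective (trans i≡m (sym prevI-toℕ))))
  ...   | no i≢m = inj₁ (inj₂ (toℕ-injective (trans i≡1+m (sym lastI-toℕ))))
    where
      i≡1+m : toℕ i ≡ suc m
      i≡1+m = ≤-antisym (≤-pred (toℕ<n i)) (≤∧≢⇒< (≮⇒≥ i≮m) (i≢m ∘ sym))

  ordinary-of : ∀ {i} → i ≢ prevI m → i ≢ lastI m → Ordinary i
  ordinary-of {i} i≢p i≢l with classify i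
  ... | inj₁ (inj₁ i≡p) = contradiction i≡p i≢p
  ... | inj₁ (inj₂ i≡l) = contradiction i≡l i≢l
  ... | inj₂ ordinary = ordinary

  build-prev : ∀ f A B → build m f A B (prevI m) ≡ A
  build-prev f A B with toℕ (prevI m) <? m
  ... | yes p<m = contradiction refl (ordinary≢prev p<m)
  ... | no _ with toℕ (prevI m) ≟ℕ m
  ...   | yes _ = refl
  ...   | no p≢m = contradiction prevI-toℕ p≢m

  build-last : ∀ f A B → build m f A B (lastI m) ≡ B
  build-last f A B with toℕ (lastI m) <? m
  ... | yes l<m = contradiction refl (ordinary≢last l<m)
  ... | no _ with toℕ (lastI m) ≟ℕ m
  ...   | yes l≡m = contradiction (trans (sym lastI-toℕ) l≡m) 1+n≢n
  ...   | no _ = refl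

  build-ordinary : ∀ f A B {i} → Ordinary i → build m f A B i ≡ f (toℕ i)
  build-ordinary f A B {i} i<m with toℕ i <? m
  ... | yes _ = refl
  ... | no i≮m = contradiction i<m i≮m

  -- duo a o b o′ c : a reports o, b reports o′, everybody else reports c.
  -- It is kept opaque: only its three defining equations below are used.
  opaque
    duo : N m → LO → N m → LO → LO → Profile m
    duo a o b o′ c = updateAt (updateAt (const c) b (const o′)) a (const o)

  opaque
    unfolding duo

    duo-first : ∀ {a b o o′ c} → duo a o b o′ c a ≡ o
    duo-first {a} = updateAt-updates a _

    duo-second : ∀ {a b o o′ c} → b ≢ a → duo a o b o′ c b ≡ o′
    duo-second {a} {b} b≢a = trans (updateAt-minimal b a _ b≢a) (updateAt-updates b _)

    duo-rest : ∀ {a b o o′ c} → ∀ {i} → i ≢ a → i ≢ b → duo a o b o′ c i ≡ c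
    duo-rest {a} {b} {i = i} i≢a i≢b =
      trans (updateAt-minimal i a _ i≢a) (updateAt-minimal i b _ i≢b)

  duo-char : ∀ {a b o o′ c} (u : Profile m) → u a ≡ o → u b ≡ o′ →
             (∀ i → i ≢ a → i ≢ b → u i ≡ c) → u ≗ duo a o b o′ c
  duo-char {a} {b} u ua ub uc i with i ≟ᶠ a | i ≟ᶠ b
  ... | yes refl | _ = trans ua (sym duo-first)
  ... | no i≢a | yes refl = trans ub (sym (duo-second i≢a))
  ... | no i≢a | no i≢b = trans (uc i i≢a i≢b) (sym (duo-rest i≢a i≢b))

  duo-comm : ∀ {a b o o′ c} → b ≢ a → duo a o b o′ c ≗ duo b o′ a o c
  duo-comm {a} {b} {o} {o′} b≢a = duo-char {a = b} {b = a} {o = o′} {o′ = o} _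
    (duo-second b≢a) duo-first (λ i i≢b i≢a → duo-rest i≢a i≢b)

  duo-swapYZ : ∀ {a b o o′ c} → b ≢ a → (λ i → swapYZ m (duo a o b o′ c i)) ≗
               duo a (swapYZ m o) b (swapYZ m o′) (swapYZ m c)
  duo-swapYZ {o = o} {o′} {c} b≢a = duo-char {o = swapYZ m o} {o′ = swapYZ m o′} {c = swapYZ m c} _
    (cong (swapYZ m) duo-first) (cong (swapYZ m) (duo-second b≢a))
    (λ i i≢a i≢b → cong (swapYZ m) (duo-rest i≢a i≢b))

  duo-ordinary : ∀ {a b o o′ c} → Ordinary a → Ordinary b →
                 duo a o b o′ c (prevI m) ≡ duo a o b o′ c (lastI m)
  duo-ordinary oa ob = trans (duo-rest (ordinary≢prev oa ∘ sym) (ordinary≢prev ob ∘ sym))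
                             (sym (duo-rest (ordinary≢last oa ∘ sym) (ordinary≢last ob ∘ sym)))

  duo-permute : ∀ {a b o o′ c} → (π : Permutation′ (suc (suc m))) {a′ b′ : N m} → b ≢ a →
                π ⟨$⟩ʳ a′ ≡ a → π ⟨$⟩ʳ b′ ≡ b →
                (λ i → duo a o b o′ c (π ⟨$⟩ʳ i)) ≗ duo a′ o b′ o′ c
  duo-permute {a} {b} {o} {o′} {c} π {a′} {b′} b≢a πa′ πb′ = duo-char {a = a′} {b = b′} _
    (trans (cong (duo a o b o′ c) πa′) duo-first)
    (trans (cong (duo a o b o′ c) πb′) (duo-second b≢a))
    (λ i i≢a′ i≢b′ → duo-rest (λ e → i≢a′ (permute-injective π (trans e (sym πa′))))
                              (λ e → i≢b′ (permute-injective π (trans e (sym πb′)))))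

  Attained : Profile m → Set
  Attained q = Σ (Profile m) λ u → InL m u × u ≗ q

  attained-resp : ∀ {q q′} → Attained q → q ≗ q′ → Attained q′
  attained-resp (u , inL , u≗q) q≗q′ = u , inL , λ i → trans (u≗q i) (q≗q′ i)

  attained-swapYZ : ∀ {q} → Attained q → Attained (λ i → swapYZ m (q i))
  attained-swapYZ (u , inL , u≗q) = _ , opYZ inL , λ i → cong (swapYZ m) (u≗q i)

  τ : Permutation′ (suc (suc m))
  τ = transpose (prevI m) (lastI m)

  τ-prev : τ ⟨$⟩ʳ prevI m ≡ lastI m
  τ-prev = transpose-first (prevI m) (lastI m)

  τ-last : τ ⟨$⟩ʳ lastI m ≡ prevI m
  τ-last = transpose-second (prevI m) (lastI m)

  attained-swapLast : ∀ {q} → Attained q → Attained (λ i → q (τ ⟨$⟩ʳ i))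
  attained-swapLast (u , inL , u≗q) = _ , opLast inL , λ i → u≗q (τ ⟨$⟩ʳ i)

  attained-permute : ∀ {q} (σ : Permutation′ (suc (suc m))) →
                     σ ⟨$⟩ʳ prevI m ≡ prevI m → σ ⟨$⟩ʳ lastI m ≡ lastI m →
                     Attained q → Attained (λ i → q (σ ⟨$⟩ʳ i))
  attained-permute σ σp σl (u , inL , u≗q) = _ , opPerm σ σp σl inL , λ i → u≗q (σ ⟨$⟩ʳ i)

  L1-duo : L1 m ≗ duo (prevI m) zyx (lastI m) xyz xyz
  L1-duo = duo-char _ (build-prev _ _ _) (build-last _ _ _)
             (λ i i≢p i≢l → build-ordinary _ _ _ (ordinary-of i≢p i≢l))

  L3-duo : L3 m ≗ duo (prevI m) yxz (lastI m) zxy xzy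
  L3-duo = duo-char _ (build-prev _ _ _) (build-last _ _ _)
             (λ i i≢p i≢l → build-ordinary _ _ _ (ordinary-of i≢p i≢l))

  -- L2 as a duo of individuals n-1 and 1; individual 1 is ordinary because n ≥ 3.
  L2-duo : 1 ≤ m → L2 m ≗ duo (prevI m) yxz fzero zxy xzy
  L2-duo 1≤m = duo-char _ (build-prev _ _ _) (build-ordinary _ _ _ 1≤m) rest
    where
      rest : ∀ i → i ≢ prevI m → i ≢ fzero → L2 m i ≡ xzy
      rest i i≢p i≢1 with classify i
      ... | inj₁ (inj₁ i≡p) = contradiction i≡p i≢p
      ... | inj₁ (inj₂ refl) = build-last _ _ _
      ... | inj₂ ordinary with i
      ...   | fzero = contradiction refl i≢1
      ...   | fsuc j = build-ordinary _ _ _ ordinary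

  -- Individual n-1 reports y≻x≻z, another one z≻x≻y, all others x≻z≻y:
  -- this is L3 if the other one is n, and a permutation of L2 otherwise.
  attained-prev-yxz : 1 ≤ m → ∀ {b} → b ≢ prevI m → Attained (duo (prevI m) yxz b zxy xzy)
  attained-prev-yxz 1≤m {b} b≢p with classify b
  ... | inj₁ (inj₁ b≡p) = contradiction b≡p b≢p
  ... | inj₁ (inj₂ refl) = L3 m , base3 , L3-duo
  ... | inj₂ ordinary =
    attained-resp (attained-permute σ σp σl (L2 m , base2 , L2-duo 1≤m))
                  (duo-permute σ (ordinary≢prev 1≤m) σp (transpose-second fzero b))
    where
      σ : Permutation′ (suc (suc m))
      σ = transpose fzero b
      σp : σ ⟨$⟩ʳ prevI m ≡ prevI m
      σp = transpose-other fzero b (prevI m) (ordinary≢prev 1≤m ∘ sym) (ordinary≢prev ordinary ∘ sym)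
      σl : σ ⟨$⟩ʳ lastI m ≡ lastI m
      σl = transpose-other fzero b (lastI m) (ordinary≢last 1≤m ∘ sym) (ordinary≢last ordinary ∘ sym)

  attained-yxz : 1 ≤ m → ∀ {a b} → Special a → b ≢ a → Attained (duo a yxz b zxy xzy)
  attained-yxz 1≤m (inj₁ refl) b≢p = attained-prev-yxz 1≤m b≢p
  attained-yxz 1≤m {b = b} (inj₂ refl) b≢l =
    attained-resp (attained-swapLast (attained-prev-yxz 1≤m τb≢p))
                  (duo-permute τ τb≢p τ-last refl)
    where
      τb≢p : τ ⟨$⟩ʳ b ≢ prevI m
      τb≢p e = b≢l (permute-injective τ (trans e (sym τ-last)))

  -- Individual n-1 reports an ordering o with x last, everyone else its
  -- reverse: this is L1, or L1 with y and z interchanged.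
  attained-bottom-prev : ∀ {o} → rank o x ≡ 2 → Attained (duo (prevI m) o (lastI m) (rev o) (rev o))
  attained-bottom-prev {xyz} ()
  attained-bottom-prev {xzy} ()
  attained-bottom-prev {yxz} ()
  attained-bottom-prev {yzx} _ =
    attained-resp (attained-swapYZ (L1 m , base1 , L1-duo)) (duo-swapYZ last≢prev)
  attained-bottom-prev {zxy} ()
  attained-bottom-prev {zyx} _ = L1 m , base1 , L1-duo

  attained-bottom-last : ∀ {o} → rank o x ≡ 2 → Attained (duo (lastI m) o (prevI m) (rev o) (rev o))
  attained-bottom-last bottom =
    attained-resp (attained-swapLast (attained-bottom-prev bottom))
                  (duo-permute τ last≢prev τ-last τ-prev)

  np-resp : ∀ {p q} → NP m p → p ≗ q → NP m q
  np-resp np p≗q u v u≢v with np u v u≢v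
  ... | i , j , hi , hj = i , j , ≻-resp (p≗q i) hi , ≻-resp (p≗q j) hj

  Covers : Profile m → Profile m → Set
  Covers p q = ∀ u v → u ≢ v → ∃ λ i → (u ≻[ p i ] v) × (u ≻[ q i ] v)

  between-NP : ∀ {p q} → Covers p q → (r : Profile m) → (∀ i → r i ≡ p i ⊎ r i ≡ q i) → NP m r
  between-NP {p} {q} cover r between u v u≢v =
    witness u v u≢v , witness v u (u≢v ∘ sym) , ranks u v u≢v , ranks v u (u≢v ∘ sym)
    where
      witness : ∀ u v → u ≢ v → N m
      witness u v u≢v = proj₁ (cover u v u≢v)
      ranks : ∀ u v (u≢v : u ≢ v) → u ≻[ r (witness u v u≢v) ] v
      ranks u v u≢v with cover u v u≢v
      ... | i , hp , hq with between i
      ...   | inj₁ ri≡pi = ≻-resp (sym ri≡pi) hp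
      ...   | inj₂ ri≡qi = ≻-resp (sym ri≡qi) hq

  mix : Profile m → Profile m → ℕ → Profile m
  mix p q k i with toℕ i <? k
  ... | yes _ = q i
  ... | no _ = p i

  module _ (p q : Profile m) where

    mix-below : ∀ {k} i → toℕ i < k → mix p q k i ≡ q i
    mix-below {k} i i<k with toℕ i <? k
    ... | yes _ = refl
    ... | no i≮k = contradiction i<k i≮k

    mix-above : ∀ {k} i → k ≤ toℕ i → mix p q k i ≡ p i
    mix-above {k} i k≤i with toℕ i <? k
    ... | yes i<k = contradiction k≤i (<⇒≱ i<k)
    ... | no _ = refl

    mix-between : ∀ k i → mix p q k i ≡ p i ⊎ mix p q k i ≡ q i
    mix-between k i with toℕ i <? k
    ... | yes _ = inj₂ refl
    ... | no _ = inj₁ refl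

    mix-step : ∀ {k} h → toℕ h ≡ k → Variant m h (mix p q k) (mix p q (suc k))
    mix-step h refl i i≢h = by-cases (toℕ i <? toℕ h)
      where
        by-cases : Dec (toℕ i < toℕ h) → mix p q (suc (toℕ h)) i ≡ mix p q (toℕ h) i
        by-cases (yes i<h) = trans (mix-below i (m≤n⇒m≤1+n i<h)) (sym (mix-below i i<h))
        by-cases (no i≮h) = trans (mix-above i h<i) (sym (mix-above i (≮⇒≥ i≮h)))
          where
            h<i : toℕ h < toℕ i
            h<i = ≤∧≢⇒< (≮⇒≥ i≮h) (λ e → i≢h (toℕ-injective (sym e)))

  module _ (g : Rule m) (sp : StrategyProof m g) where

    g-cong : ∀ {p q} (np : NP m p) (nq : NP m q) → p ≗ q → g p np ≡ g q nq
    g-cong {p} {q} np nq p≗q with g p np ≟X g q nq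
    ... | yes same = same
    ... | no differ with np (g q nq) (g p np) (differ ∘ sym)
    ...   | i , _ , gq≻gp , _ = ⊥-elim (sp i p q np nq (λ j _ → sym (p≗q j)) gq≻gp)

    Chooses : X → Profile m → Set
    Chooses a q = Σ (NP m q) λ nq → g q nq ≡ a

    chooses-resp : ∀ {a p q} → Chooses a p → p ≗ q → Chooses a q
    chooses-resp (np , gp) p≗q = nq , trans (sym (g-cong np nq p≗q)) gp
      where
        nq = np-resp np p≗q

    -- Monotonicity for a single individual h: otherwise h would manipulate
    -- from p to q, or from q to p.
    monotone-step : ∀ {a p q} h → Chooses a p → Variant m h p q → Raises a (p h) (q h) →
                    NP m q → Chooses a q
    monotone-step {a} {p} {q} h (np , gp) variant raises nq = nq , outcome
      where
        outcome : g q nq ≡ a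
        outcome with g q nq ≟X a
        ... | yes same = same
        ... | no differ with ≻-total (p h) differ
        ...   | inj₁ gq≻a =
          ⊥-elim (sp h p q np nq variant (subst (g q nq ≻[ p h ]_) (sym gp) gq≻a))
        ...   | inj₂ a≻gq =
          ⊥-elim (sp h q p nq np (λ i i≢h → sym (variant i i≢h))
                     (subst (_≻[ q h ] g q nq) (sym gp) (raises _ a≻gq)))

    -- Maskin monotonicity: change the individuals one at a time along the mixes.
    monotone : ∀ {a p q} → Chooses a p → (∀ i → Raises a (p i) (q i)) → Covers p q → Chooses a q
    monotone {a} {p} {q} cp raises cover =
      chooses-resp (mixes (suc (suc m)) ≤-refl) (λ i → mix-below p q i (toℕ<n i))
      where
        mixes : ∀ k → k ≤ suc (suc m) → Chooses a (mix p q k)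
        mixes zero _ = chooses-resp cp (λ i → sym (mix-above p q i z≤n))
        mixes (suc k) k<n =
          monotone-step h (mixes k (<⇒≤ k<n)) (mix-step p q h h≡k) raises-h
                        (between-NP cover _ (mix-between p q (suc k)))
          where
            h = fromℕ< k<n
            h≡k = toℕ-fromℕ< k<n
            raises-h : Raises a (mix p q k h) (mix p q (suc k) h)
            raises-h = subst₂ (Raises a)
                         (sym (mix-above p q h (≤-reflexive (sym h≡k))))
                         (sym (mix-below p q h (subst (_< suc k) (sym h≡k) ≤-refl)))
                         (raises h)

    raise-to-top : ∀ {a p q} → Chooses a p → (∀ i → q i ≡ p i ⊎ rank (q i) a ≡ 0) →
                   Covers p q → Chooses a q
    raise-to-top {a} {p} {q} cp keep = monotone cp raises
      where
        raises : ∀ i → Raises a (p i) (q i)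
        raises i b a≻b with keep i
        ... | inj₁ qi≡pi = ≻-resp (sym qi≡pi) a≻b
        ... | inj₂ top = top-beats (q i) top (λ { refl → ≻-irrefl (p i) a≻b })

    chooses-bottom : ∀ {p a o} → Chooses x p → p a ≡ o → rank o x ≡ 2 →
                     ∀ b → Chooses x (duo a o b (rev o) (rev o))
    chooses-bottom {p} {a} {o} cp pa bottom b = raise-to-top cp keep cover
      where
        q = duo a o b (rev o) (rev o)
        others : ∀ {i} → i ≢ a → q i ≡ rev o
        others {i} i≢a with i ≟ᶠ b
        ... | yes refl = duo-second i≢a
        ... | no i≢b = duo-rest i≢a i≢b
        keep : ∀ i → q i ≡ p i ⊎ rank (q i) x ≡ 0
        keep i with i ≟ᶠ a
        ... | yes refl = inj₁ (trans duo-first (sym pa))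
        ... | no i≢a = inj₂ (trans (cong (λ w → rank w x) (others i≢a)) (bottom-rev-top o bottom))
        -- a pair ranked u ≻ v at p by some i is so ranked at q by a or by i
        cover : Covers p q
        cover u v u≢v with proj₁ cp u v u≢v
        ... | i , _ , u≻v , _ with i ≟ᶠ a | rev-covers o u≢v
        ...   | yes refl | _ = i , u≻v , ≻-resp (trans pa (sym duo-first)) u≻v
        ...   | no _ | inj₁ u≻ₒv = a , ≻-resp (sym pa) u≻ₒv , ≻-resp (sym duo-first) u≻ₒv
        ...   | no i≢a | inj₂ u≻ᵣv = i , u≻v , ≻-resp (sym (others i≢a)) u≻ᵣv

    chooses-opposed : ∀ {p a b o c} → Chooses x p → p a ≡ o → p b ≡ rev o → rank c x ≡ 0 →
                      Chooses x (duo a o b (rev o) c)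
    chooses-opposed {p} {a} {b} {o} {c} cp pa pb top = raise-to-top cp keep cover
      where
        b≢a : b ≢ a
        b≢a refl = rev-≢ o (trans (sym pa) pb)
        keep : ∀ i → duo a o b (rev o) c i ≡ p i ⊎ rank (duo a o b (rev o) c i) x ≡ 0
        keep i with i ≟ᶠ a | i ≟ᶠ b
        ... | yes refl | _ = inj₁ (trans duo-first (sym pa))
        ... | no _ | yes refl = inj₁ (trans (duo-second b≢a) (sym pb))
        ... | no i≢a | no i≢b = inj₂ (trans (cong (λ w → rank w x) (duo-rest i≢a i≢b)) top)
        cover : Covers p (duo a o b (rev o) c)
        cover u v u≢v with rev-covers o u≢v
        ... | inj₁ u≻v = a , ≻-resp (sym pa) u≻v , ≻-resp (sym duo-first) u≻v
        ... | inj₂ u≻v = b , ≻-resp (sym pb) u≻v , ≻-resp (sym (duo-second b≢a)) u≻v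

    module _ (1≤m : 1 ≤ m) (range : RangeNP*-yz m g) where

      not-NP* : ∀ {q} → Chooses x q → q (prevI m) ≡ q (lastI m) → ⊥
      not-NP* {q} (nq , gx) same with proj₁ range q (nq , same)
      ... | inj₁ gy with trans (sym gx) gy
      ...   | ()
      not-NP* {q} (nq , gx) same | inj₂ gz with trans (sym gx) gz
      ...   | ()

      ChosenIn𝓛 : Set
      ChosenIn𝓛 = Σ (Profile m) λ u → InL m u × Chooses x u

      reach : ∀ {q} → Attained q → Chooses x q → ChosenIn𝓛
      reach (u , inL , u≗q) cq = u , inL , chooses-resp cq (sym ∘ u≗q)

      -- Case A: the raised profile is in 𝓛 when a is special, and in NP*
      -- (which is impossible) when a is ordinary.
      from-bottom : ∀ {p a o} → Chooses x p → p a ≡ o → rank o x ≡ 2 → ChosenIn𝓛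
      from-bottom {a = a} cp pa bottom with classify a
      ... | inj₁ (inj₁ refl) = reach (attained-bottom-prev bottom) (chooses-bottom cp pa bottom _)
      ... | inj₁ (inj₂ refl) = reach (attained-bottom-last bottom) (chooses-bottom cp pa bottom _)
      ... | inj₂ ordinary =
        ⊥-elim (not-NP* (chooses-bottom cp pa bottom a) (duo-ordinary ordinary ordinary))

      -- Case B: the others are made to report x≻z≻y if a is special, x≻y≻z
      -- if only b is special (the y,z-mirror of the first situation); if
      -- neither is special the raised profile would lie in NP*.
      from-opposed : ∀ {p a b} → Chooses x p → p a ≡ yxz → p b ≡ zxy → ChosenIn𝓛
      from-opposed {a = a} {b} cp pa pb with classify a
      ... | inj₁ special = reach (attained-yxz 1≤m special b≢a) (chooses-opposed cp pa pb refl)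
        where
          b≢a : b ≢ a
          b≢a refl with trans (sym pa) pb
          ... | ()
      ... | inj₂ ordinaryᵃ with classify b
      ...   | inj₁ special =
        reach (attained-resp (attained-swapYZ (attained-yxz 1≤m special a≢b))
                             (λ i → trans (duo-swapYZ a≢b i) (duo-comm a≢b i)))
              (chooses-opposed cp pa pb refl)
        where
          a≢b : a ≢ b
          a≢b refl = [ ordinary≢prev ordinaryᵃ , ordinary≢last ordinaryᵃ ]′ special
      ...   | inj₂ ordinaryᵇ =
        ⊥-elim (not-NP* (chooses-opposed {c = xzy} cp pa pb refl) (duo-ordinary ordinaryᵃ ordinaryᵇ))

      -- Someone ranks y above x and someone ranks z above x.
      x-in-𝓛 : ∀ {p} → Chooses x p → ChosenIn𝓛
      x-in-𝓛 {p} cp with proj₁ cp y x (λ ()) | proj₁ cp z x (λ ())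
      ... | a , _ , y≻x , _ | b , _ , z≻x , _ with y-above-x (p a) y≻x | z-above-x (p b) z≻x
      ...   | inj₁ bottom | _ = from-bottom cp refl bottom
      ...   | inj₂ _ | inj₁ bottom = from-bottom cp refl bottom
      ...   | inj₂ pa | inj₂ pb = from-opposed cp pa pb

mainTheorem4 : (m : ℕ) → 1 ≤ m → (g : Rule m) →
    StrategyProof m g → RangeNP*-yz m g → InRange m g x →
    Σ (Profile m) λ u → InL m u × Σ (NP m u) λ nu → g u nu ≡ x
mainTheorem4 m 1≤m g sp range (p , np , gp) = x-in-𝓛 m g sp 1≤m range (np , gp)
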